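{- (a) Let $m,n\ge 0$ and let $A\subseteq[m+n]$ with $|A|=n$. For $I\subseteq[m-1]$ and $J\subseteq[n-1]$, \[ \mathbf{m}_A\big(\dot\chi^I(\nu),\dot\chi^J(\nu)\big)=\dot\chi^{\,I\sqcup\!\sqcup_A J}(\nu), \qquad\text{where } I\sqcup\!\sqcup_A J := c_1(A)\sqcup\big((I\#_A J)\setminus c(A)\big). \] (b) Let $n\ge 2$ and $1\le k\le n-1$. For $I\subseteq[n-1]$, \[ \blacktriangle_k\big(\dot\chi^I(\nu)\big)=\dot\chi^{I\cap[k-1]}(\nu)\otimes\dot\chi^{(I\cap[k+1,n-1])-k}(\nu). \]
   Context: Fix an integer $\nu>1$ and let $C_\nu$ be the cyclic group of order $\nu$, with trivial character $\mathbbm{1}$ and regular character $\mathrm{reg}$. For a finite set $S$ of integers let $Q_S(\nu)=\bigoplus_{s\in S}C_\nu$, and $Q_n(\nu):=Q_{[n-1]}(\nu)$ (where $[a,b]=\{a,\dots,b\}$, $[n]=[1,n]$). For $I\subseteq S$, the supercharacter of the normal supercharacter theory of $Q_S(\nu)$ given by the lattice $\{Q_I(\nu):I\subseteq S\}$ is $\chi^I(\nu)(\mathbf g)=\prod_{i\in I}\mathbbm{1}(g_i)\prod_{j\in S\setminus I}(\mathrm{reg}-\mathbbm{1})(g_j)$, and $\dot\chi^I(\nu):=\chi^I(\nu)/\chi^I(\nu)(\mathbf 0)$, i.e. $\dot\chi^I(\nu)(\mathbf g)=\prod_{i\in I}\mathbbm{1}(g_i)\prod_{j\in S\setminus I}\frac{(\mathrm{reg}-\mathbbm{1})(g_j)}{\nu-1}$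 (the ambient set $S$ is understood from context). For $S=\{s_1<\dots<s_t\}$, $\iota_S:Q_S(\nu)\to Q_{t+1}(\nu)$, $(g_s)\mapsto(g_{s_i})_{1\le i\le t}$, and $\iota_S^*(\phi)=\phi\circ\iota_S$; for $I\subseteq[t]$, $S_I:=\{s_i:i\in I\}$. Identifying $Q_T(\nu)=Q_S(\nu)\times Q_{T\setminus S}(\nu)$ for $S\subseteq T$, set $(\phi\otimes_S\psi)(a,b)=\phi(a)\psi(b)$; $\otimes_1$ denotes this with $S$ all but the last coordinate (so for $\phi$ a class function on $Q_m(\nu)$ and $\psi$ one on $C_\nu$, $\phi\otimes_1\psi$ is a class function on $Q_{m+1}(\nu)$). For $A\subseteq[m+n]$, a subset is connected if it consists of consecutive integers; let $c_1(A)=\{\max B: B$ a maximal connected subset of $A\}\setminus\{m+n\}$, $c_2(A)$ the same for $A^c=[m+n]\setminus A$, and $c(A)=c_1(A)\cup c_2(A)$. For $\phi$ a class function on $Q_m(\nu)$ and $\psi$ one on $Q_n(\nu)$, $\mathbf s_A(\phi,\psi):=\iota_{A^c}^*\big(\phi\otimes_1\tfrac{\mathrm{reg}-\mathbbm{1}}{\nu-1}\big)\otimes_{A^c}\iota_A^*\big(\psi\otimes_1\tfrac{\mathrm{reg}-\mathbbm{1}}{\nu-1}\big)$, a class function on $Q_{m+n+1}(\nu)$. Then $\mathbf m_A(\phi,\psi)=\phi\psi$ if $m=0$ or $n=0$, and otherwise $\mathbf m_A(\phi,\psi)=\dot\chi^{c_1(A)}(\nu)\otimes_{c(A)}\big(\mathbf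 s_A(\phi,\psi)\downarrow^{Q_{m+n+1}(\nu)}_{Q_{[m+n-1]\setminus c(A)}(\nu)}\big)$, a class function on $Q_{m+n}(\nu)$, with $\dot\chi^{c_1(A)}(\nu)$ viewed on $Q_{c(A)}(\nu)$. The $A$-preshuffle $I\#_A J$ is the subset $(A^c)_{I}\sqcup A_{J}$ of $[m+n]$ (with $I\subseteq[m]$, $J\subseteq[n]$), regarded as a subset of $[m+n-1]$. For $\phi$ a class function on $Q_n(\nu)$ and $1\le k\le n-1$, choose $\phi_1^k$ on $Q_{[1,k-1]}(\nu)$ and $\phi_2^k$ on $Q_{[k+1,n-1]}(\nu)$ with $\phi\downarrow_{Q_{[1,k-1]\sqcup[k+1,n-1]}(\nu)}=\phi_1^k\otimes_{[1,k-1]}\phi_2^k$; then $\blacktriangle_k(\phi)=\phi_1^k\otimes(\iota^*_{[k+1,n-1]})^{ -1}(\phi_2^k)$. For $S\subseteq[k+1,n-1]$, $S-k=\{s-k:s\in S\}$. -}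

module Defs where

open import Data.Nat using (ℕ; zero; suc; _+_; _∸_; pred; _≤_; _<_; s≤s; z≤n)
open import Data.Nat.Properties using (+-identityʳ; m+n∸n≡m; m+[n∸m]≡n; m∸n≢0⇒n<m)
open import Data.Bool using (Bool; true; false; not; _∧_)
open import Data.Fin using (Fin; zero; suc)
open import Data.Fin.Subset using (Subset; ∁; _∪_; _─_; ∣_∣)
open import Data.Fin.Subset.Properties using (∣∁p∣≡n∸∣p∣)
open import Data.Vec using (Vec; []; _∷_; _∷ʳ_; _++_; cast; init; last; zipWith; foldr; splitAt; toList)
open import Data.List using (List)
import Data.List as L
open import Data.Integer using (+_)
open import Data.Rational using (ℚ; 1ℚ; _*_; _-_; _/_; -_; 0ℚ)
open import Data.Product using (Σ; _×_; _,_; proj₁; proj₂)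
open import Relation.Binary.PropositionalEquality using (_≡_; refl; sym; trans; cong)

-- Conventions.
-- * ν = 2 + μ  (so quantifying over μ : ℕ is the same as over integers ν > 1).
-- * An element of Q_S(ν) = ⊕_{s∈S} C_ν with S = {s₁ < … < s_t} is the vector
--   (g_{s₁}, …, g_{s_t}) : Vec (Fin ν) t  (C_ν = Fin ν, 0 = zero).
--   In particular Q_n(ν) = Q_{[n-1]}(ν) has elements Vec (Fin ν) (pred n).
-- * A subset of [N] = {1,…,N} is a Subset N (position i ↔ integer i+1).
-- * Class functions take values in ℚ (all functions involved are ℚ-valued;
--   Q_S(ν) is abelian so every function is a class function).

module _ (μ : ℕ) where

  ν : ℕ
  ν = suc (suc μ)

  G : ℕ → Set
  G t = Vec (Fin ν) t

  CF : ℕ → Set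
  CF t = G t → ℚ

  triv : Fin ν → ℚ
  triv _ = 1ℚ

  reg : Fin ν → ℚ
  reg zero    = + ν / 1
  reg (suc _) = 0ℚ

  ρ : Fin ν → ℚ
  ρ g = (reg g - triv g) * (+ 1 / suc μ)

  prod : ∀ {t} → Vec ℚ t → ℚ
  prod = foldr _ _*_ 1ℚ

  -- normalised supercharacter  χ̇^I(ν)  on Q_S(ν), S the ambient coordinate
  -- set (of size t), I given as a subset of the positions of S.
  χ̇ : ∀ {t} → Subset t → CF t
  χ̇ I g = prod (zipWith f I g)
    where
    f : Bool → Fin ν → ℚ
    f true  x = triv x
    f false x = ρ x

  proj : ∀ {N} {X : Set} (S : Subset N) → Vec X N → Vec X ∣ S ∣
  proj []          []       = []
  proj (true  ∷ S) (x ∷ g)  = x ∷ proj S g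
  proj (false ∷ S) (x ∷ g)  = proj S g

  embed : ∀ {N} (S : Subset N) → G ∣ S ∣ → G N
  embed []          []       = []
  embed (true  ∷ S) (x ∷ g)  = x ∷ embed S g
  embed (false ∷ S) g        = zero ∷ embed S g

  tensorOn : ∀ {N} (S : Subset N) → CF ∣ S ∣ → CF ∣ ∁ S ∣ → CF N
  tensorOn S φ ψ g = φ (proj S g) * ψ (proj (∁ S) g)

  ι* : ∀ {N t} (S : Subset N) → ∣ S ∣ ≡ t → CF t → CF ∣ S ∣
  ι* S eq F x = F (cast eq x)

  _⊗₁_ : ∀ {t} → CF t → (Fin ν → ℚ) → CF (suc t)
  (φ ⊗₁ ψ) g = φ (init g) * ψ (last g)

  -- c₁, c₂, c for A ⊆ [N]; result a subset of [N-1].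
  -- max of a maximal connected block of A other than N
  --   = an a ∈ [N-1] with a ∈ A and a+1 ∉ A.
  ends : ∀ {N} → Subset N → Subset (pred N)
  ends []            = []
  ends (a ∷ [])      = []
  ends (a ∷ b ∷ r)   = (a ∧ not b) ∷ ends (b ∷ r)

  c₁ c₂ c : ∀ {N} → Subset N → Subset (pred N)
  c₁ A = ends A
  c₂ A = ends (∁ A)
  c  A = c₁ A ∪ c₂ A

  -- S_I = {s_i : i ∈ I} for S = {s₁<…<s_t}, I ⊆ [t] given by its indicator
  -- list (entries beyond the list are “not in I”).
  pick : ∀ {N} → Subset N → List Bool → Subset N
  pick []          _          = []
  pick (true  ∷ S) L.[]       = false ∷ pick S L.[]
  pick (true  ∷ S) (b L.∷ bs) = b ∷ pick S bs
  pick (false ∷ S) bs         = false ∷ pick S bs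

  dropLast : ∀ {N} {X : Set} → Vec X N → Vec X (pred N)
  dropLast []          = []
  dropLast (x ∷ [])    = []
  dropLast (x ∷ y ∷ r) = x ∷ dropLast (y ∷ r)

  -- A-preshuffle  I #_A J = (A^c)_I ⊔ A_J  ⊆ [m+n], regarded in [m+n-1]
  preshuffle : ∀ m n (A : Subset (m + n)) → Subset (pred m) → Subset (pred n)
             → Subset (pred (m + n))
  preshuffle m n A I J = dropLast (pick (∁ A) (toList I) ∪ pick A (toList J))

  shuffle : ∀ m n (A : Subset (m + n)) → Subset (pred m) → Subset (pred n)
          → Subset (pred (m + n))
  shuffle m n A I J = c₁ A ∪ (preshuffle m n A I J ─ c A)

  ∣∁∁∣ : ∀ {N} (A : Subset N) → ∣ ∁ (∁ A) ∣ ≡ ∣ A ∣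
  ∣∁∁∣ []          = refl
  ∣∁∁∣ (true  ∷ A) = cong suc (∣∁∁∣ A)
  ∣∁∁∣ (false ∷ A) = ∣∁∁∣ A

  card∁ : ∀ m n (A : Subset (m + n)) → ∣ A ∣ ≡ n → ∣ ∁ A ∣ ≡ m
  card∁ m n A h = trans (∣∁p∣≡n∸∣p∣ A) (trans (cong ((m + n) ∸_) h) (m+n∸n≡m m n))

  card∁∁ : ∀ {N} n (A : Subset N) → ∣ A ∣ ≡ n → ∣ ∁ (∁ A) ∣ ≡ n
  card∁∁ n A h = trans (∣∁∁∣ A) h

  -- s_A(φ,ψ) on Q_{m+n+1}(ν)  (here for m, n ≥ 1, written suc m, suc n)
  sA : ∀ m n (A : Subset (suc m + suc n)) → ∣ A ∣ ≡ suc n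
     → CF m → CF n → CF (suc m + suc n)
  sA m n A h φ ψ =
    tensorOn (∁ A) (ι* (∁ A) (card∁ (suc m) (suc n) A h) (φ ⊗₁ ρ))
                   (ι* (∁ (∁ A)) (card∁∁ (suc n) A h) (ψ ⊗₁ ρ))

  mA : ∀ m n (A : Subset (m + n)) → ∣ A ∣ ≡ n
     → CF (pred m) → CF (pred n) → CF (pred (m + n))
  mA zero    n       A h φ ψ g = φ [] * ψ g
  mA (suc m) zero    A h φ ψ g = φ (cast (+-identityʳ m) g) * ψ []
  mA (suc m) (suc n) A h φ ψ =
    tensorOn (c A) (χ̇ (proj (c A) (c₁ A)))
      -- restriction of s_A(φ,ψ) to Q_{[m+n-1]∖c(A)} ⊆ Q_{[m+n]}
      (λ x → sA m n A h φ ψ (embed (∁ (c A)) x ∷ʳ zero))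

  -- For 1 ≤ k < n:  Q_{[1,k-1] ⊔ [k+1,n-1]}(ν) ⊆ Q_n(ν) consists of
  -- a ++ (0 ∷ b) with a ∈ Q_{[1,k-1]}, b ∈ Q_{[k+1,n-1]}; the coordinate
  -- relabelling ι_{[k+1,n-1]} is the identity on vectors of length n-k-1.

  splitEq : ∀ n k → 1 ≤ k → k < n → pred k + suc (pred (n ∸ k)) ≡ pred n
  splitEq (suc n) (suc k) (s≤s z≤n) (s≤s k<n) = lem n k k<n
    where
    lem : ∀ n k → k < n → k + suc (pred (n ∸ k)) ≡ n
    lem (suc n) zero    _         = refl
    lem (suc n) (suc k) (s≤s k<n) = cong suc (lem n k k<n)

  glue : ∀ n k → pred k + suc (pred (n ∸ k)) ≡ pred n
       → G (pred k) → G (pred (n ∸ k)) → G (pred n)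
  glue n k eq a b = cast eq (a ++ (zero ∷ b))

  Decomp : ∀ n k → pred k + suc (pred (n ∸ k)) ≡ pred n
         → CF (pred n) → CF (pred k) → CF (pred (n ∸ k)) → Set
  Decomp n k eq φ φ₁ φ₂ = ∀ a b → φ (glue n k eq a b) ≡ φ₁ a * φ₂ b

  -- “▲_k(φ) = F” (F a class function on Q_k(ν) × Q_{n-k}(ν)): a decomposition
  -- exists, and for every decomposition φ₁ ⊗ (ι^*)⁻¹ φ₂ = F.
  TriangleIs : ∀ n k → pred k + suc (pred (n ∸ k)) ≡ pred n
             → CF (pred n) → (G (pred k) → G (pred (n ∸ k)) → ℚ) → Set
  TriangleIs n k eq φ F =
    Σ (CF (pred k)) (λ φ₁ → Σ (CF (pred (n ∸ k))) (λ φ₂ → Decomp n k eq φ φ₁ φ₂))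
    × (∀ φ₁ φ₂ → Decomp n k eq φ φ₁ φ₂ → ∀ a b → φ₁ a * φ₂ b ≡ F a b)

-- I ∩ [k-1] ⊆ [k-1]  and  (I ∩ [k+1,n-1]) - k ⊆ [n-k-1], for I ⊆ [n-1]
lowPart : ∀ n k → pred k + suc (pred (n ∸ k)) ≡ pred n
        → Subset (pred n) → Subset (pred k)
lowPart n k eq I = proj₁ (splitAt (pred k) (cast (sym eq) I))

highPart : ∀ n k → pred k + suc (pred (n ∸ k)) ≡ pred n
         → Subset (pred n) → Subset (pred (n ∸ k))
highPart n k eq I with splitAt (pred k) (cast (sym eq) I)
... | _ , (_ ∷ rest) , _ = rest

{-# OPTIONS --safe #-}
module Submission where

-- χ̇^I is a product over the coordinates of factors 𝟙 (coordinates in I) and ρ = (reg − 𝟙)/(ν − 1)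
-- (the others), and both factors take the value 1 at 0. So tensoring and ι^* only re-index the
-- factors, and restricting to a coordinate subgroup simply drops the factors of the missing
-- coordinates. In m_A the factors of I and J land at (A^c)_I and A_J, the extra ρ coming from
-- ⊗₁ sits on the last coordinate, which is evaluated at 0, and the coordinates in c(A) carry
-- χ̇^{c₁(A)}; for ▲_k the product splits at the coordinate k, which is again evaluated at 0.

open import Defs
open import Algebra.Bundles using (CommutativeMonoid)
open import Algebra.Lattice.Properties.BooleanAlgebra as BooleanAlgebraProperties using ()
open import Data.Bool using (Bool; true; false)
open import Data.Bool.Properties using (∨-identityʳ)
open import Data.Fin using (Fin; zero)
open import Data.Fin.Subset using (Subset; ∣_∣; ∁; _∪_; _─_; ⊤; ⊥)
open import Data.Fin.Subset.Properties
  using (∣p∣≡n⇒p≡⊤; ∪-identityˡ; ∪-identityʳ; p─⊥≡p; ∪-∩-booleanAlgebra)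
open import Data.Integer using (+_)
import Data.List as List
open import Data.Nat using (ℕ; zero; suc; pred; _+_; _≤_; _<_)
import Data.Nat as ℕ
open import Data.Nat.Properties using (+-identityʳ)
open import Data.Nat.Tactic.RingSolver using (solve-∀)
open import Data.Product using (_×_; _,_)
open import Data.Rational using (ℚ; 1ℚ; _*_; _-_; -_; _/_; toℚᵘ)
open import Data.Rational.Properties
  using (toℚᵘ-injective; toℚᵘ-homo-*; toℚᵘ-homo-+; toℚᵘ-homo‿-; toℚᵘ-fromℚᵘ;
         *-identityˡ; *-identityʳ; *-assoc; *-1-commutativeMonoid)
import Data.Rational.Unnormalised as ℚᵘ
import Data.Rational.Unnormalised.Properties as ℚᵘ
open import Data.Vec using (Vec; []; _∷_; _∷ʳ_; _++_; cast; toList; replicate; initLast; splitAt)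
open import Data.Vec.Properties using (cast-is-id; toList-∷ʳ; toList-cast)
open import Relation.Binary.PropositionalEquality
  using (_≡_; refl; sym; trans; cong; cong₂; module ≡-Reasoning)

open import Algebra.Properties.CommutativeSemigroup
  (CommutativeMonoid.commutativeSemigroup *-1-commutativeMonoid) using (x∙yz≈y∙xz)

ρ-zero : ∀ μ → ρ μ zero ≡ 1ℚ
ρ-zero μ = toℚᵘ-injective (begin
  toℚᵘ ((νℚ - 1ℚ) * inv)
    ≈⟨ toℚᵘ-homo-* (νℚ - 1ℚ) inv ⟩
  toℚᵘ (νℚ - 1ℚ) ℚᵘ.* toℚᵘ inv
    ≈⟨ ℚᵘ.*-cong (ℚᵘ.≃-trans (toℚᵘ-homo-+ νℚ (- 1ℚ))
                             (ℚᵘ.+-cong (toℚᵘ-fromℚᵘ (ℚᵘ.mkℚᵘ (+ suc (suc μ)) 0)) (toℚᵘ-homo‿- 1ℚ)))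
                 (toℚᵘ-fromℚᵘ (ℚᵘ.mkℚᵘ (+ 1) μ)) ⟩
  (ℚᵘ.mkℚᵘ (+ suc (suc μ)) 0 ℚᵘ.- toℚᵘ 1ℚ) ℚᵘ.* ℚᵘ.mkℚᵘ (+ 1) μ
    ≈⟨ ℚᵘ.*≡* (cong (λ x → + suc x) (cross-multiplied μ)) ⟩
  toℚᵘ 1ℚ ∎)
  where
  open ℚᵘ.≃-Reasoning
  νℚ inv : ℚ
  νℚ  = + suc (suc μ) / 1
  inv = + 1 / suc μ
  -- (ν − 1) · 1 = 1 · (μ + 1), cross-multiplied as ℚᵘ.*≡* wants it
  cross-multiplied : ∀ μ → μ ℕ.* 1 ℕ.* 1 ℕ.* 1
                         ≡ μ + 0 ℕ.* suc μ + 0 ℕ.* suc (μ + 0 ℕ.* suc μ)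
  cross-multiplied = solve-∀

∣p∣≡0⇒p≡⊥ : ∀ {n} (p : Subset n) → ∣ p ∣ ≡ 0 → p ≡ ⊥
∣p∣≡0⇒p≡⊥ []          _  = refl
∣p∣≡0⇒p≡⊥ (false ∷ p) eq = cong (false ∷_) (∣p∣≡0⇒p≡⊥ p eq)

module SubsetBooleanAlgebra (n : ℕ) = BooleanAlgebraProperties (∪-∩-booleanAlgebra n)

∁-involutive : ∀ {n} (p : Subset n) → ∁ (∁ p) ≡ p
∁-involutive {n} = SubsetBooleanAlgebra.¬-involutive n

∁⊤≡⊥ : ∀ {n} → ∁ (⊤ {n}) ≡ ⊥
∁⊤≡⊥ {n} = SubsetBooleanAlgebra.¬⊤≈⊥ n

∁⊥≡⊤ : ∀ {n} → ∁ (⊥ {n}) ≡ ⊤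
∁⊥≡⊤ {n} = SubsetBooleanAlgebra.¬⊥≈⊤ n

module _ (μ : ℕ) where

  open ≡-Reasoning

  factor : Bool → Fin (ν μ) → ℚ
  factor true  _ = 1ℚ
  factor false x = ρ μ x

  factor-zero : ∀ b → factor b zero ≡ 1ℚ
  factor-zero true  = refl
  factor-zero false = ρ-zero μ

  χ̇-∷ : ∀ {t} b x (I : Subset t) (g : G μ t) → χ̇ μ (b ∷ I) (x ∷ g) ≡ factor b x * χ̇ μ I g
  χ̇-∷ true  x I g = refl
  χ̇-∷ false x I g = refl

  χ̇-∷-zero : ∀ {t} b (I : Subset t) (g : G μ t) → χ̇ μ (b ∷ I) (zero ∷ g) ≡ χ̇ μ I g
  χ̇-∷-zero b I g = begin
    χ̇ μ (b ∷ I) (zero ∷ g)     ≡⟨ χ̇-∷ b zero I g ⟩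
    factor b zero * χ̇ μ I g    ≡⟨ cong (_* χ̇ μ I g) (factor-zero b) ⟩
    1ℚ * χ̇ μ I g               ≡⟨ *-identityˡ _ ⟩
    χ̇ μ I g                    ∎

  χ̇-cast : ∀ {s t} (e : s ≡ t) (I : Subset t) (g : G μ s) → χ̇ μ I (cast e g) ≡ χ̇ μ (cast (sym e) I) g
  χ̇-cast refl I g = cong₂ (χ̇ μ) (sym (cast-is-id refl I)) (cast-is-id refl g)

  χ̇-++ : ∀ {s t} (I : Subset s) (J : Subset t) g h → χ̇ μ (I ++ J) (g ++ h) ≡ χ̇ μ I g * χ̇ μ J h
  χ̇-++ []      J []      h = sym (*-identityˡ _)
  χ̇-++ (b ∷ I) J (x ∷ g) h = begin
    χ̇ μ (b ∷ I ++ J) (x ∷ g ++ h)        ≡⟨ χ̇-∷ b x (I ++ J) (g ++ h) ⟩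
    factor b x * χ̇ μ (I ++ J) (g ++ h)   ≡⟨ cong (factor b x *_) (χ̇-++ I J g h) ⟩
    factor b x * (χ̇ μ I g * χ̇ μ J h)     ≡⟨ *-assoc (factor b x) _ _ ⟨
    factor b x * χ̇ μ I g * χ̇ μ J h       ≡⟨ cong (_* χ̇ μ J h) (χ̇-∷ b x I g) ⟨
    χ̇ μ (b ∷ I) (x ∷ g) * χ̇ μ J h        ∎

  χ̇-∷ʳ : ∀ {t} (I : Subset t) b g x → χ̇ μ (I ∷ʳ b) (g ∷ʳ x) ≡ χ̇ μ I g * factor b x
  χ̇-∷ʳ []      b []      x = trans (χ̇-∷ b x [] []) (trans (*-identityʳ (factor b x)) (sym (*-identityˡ (factor b x))))
  χ̇-∷ʳ (a ∷ I) b (y ∷ g) x = begin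
    χ̇ μ ((a ∷ I) ∷ʳ b) ((y ∷ g) ∷ʳ x)      ≡⟨ χ̇-∷ a y (I ∷ʳ b) (g ∷ʳ x) ⟩
    factor a y * χ̇ μ (I ∷ʳ b) (g ∷ʳ x)    ≡⟨ cong (factor a y *_) (χ̇-∷ʳ I b g x) ⟩
    factor a y * (χ̇ μ I g * factor b x)   ≡⟨ *-assoc (factor a y) _ _ ⟨
    factor a y * χ̇ μ I g * factor b x     ≡⟨ cong (_* factor b x) (χ̇-∷ a y I g) ⟨
    χ̇ μ (a ∷ I) (y ∷ g) * factor b x      ∎

  χ̇-⊗₁-ρ : ∀ {t} (I : Subset t) (g : G μ (suc t)) → (_⊗₁_ μ (χ̇ μ I) (ρ μ)) g ≡ χ̇ μ (I ∷ʳ false) g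
  -- init and last are projections of initLast, so this with also rewrites init g and last g
  χ̇-⊗₁-ρ I g with initLast g
  ... | h , x , refl = sym (χ̇-∷ʳ I false h x)

  dropLast-∷ʳ : ∀ {t} {X : Set} (v : Vec X t) x → dropLast μ (v ∷ʳ x) ≡ v
  dropLast-∷ʳ []          x = refl
  dropLast-∷ʳ (y ∷ [])    x = refl
  dropLast-∷ʳ (y ∷ z ∷ v) x = cong (y ∷_) (dropLast-∷ʳ (z ∷ v) x)

  χ̇-∷ʳ-zero : ∀ {t} (I : Subset (suc t)) (g : G μ t) → χ̇ μ I (g ∷ʳ zero) ≡ χ̇ μ (dropLast μ I) g
  χ̇-∷ʳ-zero I g with initLast I
  ... | J , b , refl = begin
    χ̇ μ (J ∷ʳ b) (g ∷ʳ zero)        ≡⟨ χ̇-∷ʳ J b g zero ⟩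
    χ̇ μ J g * factor b zero         ≡⟨ cong (χ̇ μ J g *_) (factor-zero b) ⟩
    χ̇ μ J g * 1ℚ                    ≡⟨ *-identityʳ _ ⟩
    χ̇ μ J g                         ≡⟨ cong (λ K → χ̇ μ K g) (dropLast-∷ʳ J b) ⟨
    χ̇ μ (dropLast μ (J ∷ʳ b)) g     ∎

  χ̇-embed : ∀ {N} (S : Subset N) (I : Subset N) g → χ̇ μ I (embed μ S g) ≡ χ̇ μ (proj μ S I) g
  χ̇-embed []          []      []      = refl
  χ̇-embed (true  ∷ S) (b ∷ I) (x ∷ g) = begin
    χ̇ μ (b ∷ I) (x ∷ embed μ S g)     ≡⟨ χ̇-∷ b x I (embed μ S g) ⟩
    factor b x * χ̇ μ I (embed μ S g)  ≡⟨ cong (factor b x *_) (χ̇-embed S I g) ⟩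
    factor b x * χ̇ μ (proj μ S I) g   ≡⟨ χ̇-∷ b x (proj μ S I) g ⟨
    χ̇ μ (b ∷ proj μ S I) (x ∷ g)      ∎
  χ̇-embed (false ∷ S) (b ∷ I) g       = trans (χ̇-∷-zero b I (embed μ S g)) (χ̇-embed S I g)

  merge : ∀ {N} (S : Subset N) → Subset ∣ S ∣ → Subset ∣ ∁ S ∣ → Subset N
  merge []          []      []      = []
  merge (true  ∷ S) (b ∷ K) L       = b ∷ merge S K L
  merge (false ∷ S) K       (b ∷ L) = b ∷ merge S K L

  χ̇-tensorOn : ∀ {N} (S : Subset N) K L (g : G μ N) →
               tensorOn μ S (χ̇ μ K) (χ̇ μ L) g ≡ χ̇ μ (merge S K L) g
  χ̇-tensorOn []          []      []      []      = *-identityˡ 1ℚ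
  χ̇-tensorOn (true  ∷ S) (b ∷ K) L       (x ∷ g) = begin
    χ̇ μ (b ∷ K) (x ∷ proj μ S g) * χ̇ μ L (proj μ (∁ S) g)
      ≡⟨ cong (_* χ̇ μ L (proj μ (∁ S) g)) (χ̇-∷ b x K (proj μ S g)) ⟩
    factor b x * χ̇ μ K (proj μ S g) * χ̇ μ L (proj μ (∁ S) g)
      ≡⟨ *-assoc (factor b x) _ _ ⟩
    factor b x * tensorOn μ S (χ̇ μ K) (χ̇ μ L) g
      ≡⟨ cong (factor b x *_) (χ̇-tensorOn S K L g) ⟩
    factor b x * χ̇ μ (merge S K L) g
      ≡⟨ χ̇-∷ b x (merge S K L) g ⟨
    χ̇ μ (b ∷ merge S K L) (x ∷ g) ∎
  χ̇-tensorOn (false ∷ S) K       (b ∷ L) (x ∷ g) = begin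
    χ̇ μ K (proj μ S g) * χ̇ μ (b ∷ L) (x ∷ proj μ (∁ S) g)
      ≡⟨ cong (χ̇ μ K (proj μ S g) *_) (χ̇-∷ b x L (proj μ (∁ S) g)) ⟩
    χ̇ μ K (proj μ S g) * (factor b x * χ̇ μ L (proj μ (∁ S) g))
      ≡⟨ x∙yz≈y∙xz (χ̇ μ K (proj μ S g)) (factor b x) _ ⟩
    factor b x * tensorOn μ S (χ̇ μ K) (χ̇ μ L) g
      ≡⟨ cong (factor b x *_) (χ̇-tensorOn S K L g) ⟩
    factor b x * χ̇ μ (merge S K L) g
      ≡⟨ χ̇-∷ b x (merge S K L) g ⟨
    χ̇ μ (b ∷ merge S K L) (x ∷ g) ∎

  pick-[] : ∀ {N} (S : Subset N) → pick μ S List.[] ≡ ⊥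
  pick-[] []          = refl
  pick-[] (true  ∷ S) = cong (false ∷_) (pick-[] S)
  pick-[] (false ∷ S) = cong (false ∷_) (pick-[] S)

  pick-++-false : ∀ {N} (S : Subset N) L → pick μ S (L List.++ List.[ false ]) ≡ pick μ S L
  pick-++-false []          L            = refl
  pick-++-false (true  ∷ S) List.[]      = refl
  pick-++-false (true  ∷ S) (b List.∷ L) = cong (b ∷_) (pick-++-false S L)
  pick-++-false (false ∷ S) L            = cong (false ∷_) (pick-++-false S L)

  pick-∷ʳ-false : ∀ {N t} (S : Subset N) (I : Subset t) →
                  pick μ S (toList (I ∷ʳ false)) ≡ pick μ S (toList I)
  pick-∷ʳ-false S I = trans (cong (pick μ S) (toList-∷ʳ false I)) (pick-++-false S (toList I))

  pick-⊤ : ∀ {t} (I : Subset t) → pick μ ⊤ (toList I) ≡ I ∷ʳ false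
  pick-⊤ []      = refl
  pick-⊤ (b ∷ I) = cong (b ∷_) (pick-⊤ I)

  merge-pick : ∀ {N} (S : Subset N) K L → merge S K L ≡ pick μ S (toList K) ∪ pick μ (∁ S) (toList L)
  merge-pick []          []      []      = refl
  merge-pick (true  ∷ S) (b ∷ K) L       = cong₂ _∷_ (sym (∨-identityʳ b)) (merge-pick S K L)
  merge-pick (false ∷ S) K       (b ∷ L) = cong (b ∷_) (merge-pick S K L)

  merge-proj : ∀ {N} (X Z Y : Subset N) →
               merge (X ∪ Z) (proj μ (X ∪ Z) X) (proj μ (∁ (X ∪ Z)) Y) ≡ X ∪ (Y ─ (X ∪ Z))
  merge-proj []          []          []      = refl
  merge-proj (true  ∷ X) (z     ∷ Z) (y ∷ Y) = cong (true ∷_) (merge-proj X Z Y)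
  merge-proj (false ∷ X) (true  ∷ Z) (y ∷ Y) = cong (false ∷_) (merge-proj X Z Y)
  merge-proj (false ∷ X) (false ∷ Z) (y ∷ Y) = cong (y ∷_) (merge-proj X Z Y)

  ends-replicate : ∀ k b → ends μ (replicate k b) ≡ ⊥
  ends-replicate zero          b     = refl
  ends-replicate (suc zero)    b     = refl
  ends-replicate (suc (suc k)) true  = cong (false ∷_) (ends-replicate (suc k) true)
  ends-replicate (suc (suc k)) false = cong (false ∷_) (ends-replicate (suc k) false)

  χ̇-ι*-⊗₁-ρ : ∀ {N t} (S : Subset N) (e : ∣ S ∣ ≡ suc t) (I : Subset t) g →
              ι* μ S e (_⊗₁_ μ (χ̇ μ I) (ρ μ)) g ≡ χ̇ μ (cast (sym e) (I ∷ʳ false)) g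
  χ̇-ι*-⊗₁-ρ S e I g = trans (χ̇-⊗₁-ρ I (cast e g)) (χ̇-cast e (I ∷ʳ false) g)

  pick-cast-∷ʳ-false : ∀ {N s t} (S : Subset N) (e : s ≡ suc t) (I : Subset t) →
                       pick μ S (toList (cast (sym e) (I ∷ʳ false))) ≡ pick μ S (toList I)
  pick-cast-∷ʳ-false S e I =
    trans (cong (pick μ S) (toList-cast (sym e) (I ∷ʳ false))) (pick-∷ʳ-false S I)

  sA-χ̇ : ∀ m n (A : Subset (suc m + suc n)) (hA : ∣ A ∣ ≡ suc n) (I : Subset m) (J : Subset n) g →
         sA μ m n A hA (χ̇ μ I) (χ̇ μ J) g ≡ χ̇ μ (pick μ (∁ A) (toList I) ∪ pick μ A (toList J)) g
  sA-χ̇ m n A hA I J g = begin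
    sA μ m n A hA (χ̇ μ I) (χ̇ μ J) g
      ≡⟨ cong₂ _*_ (χ̇-ι*-⊗₁-ρ (∁ A) eᵐ I _) (χ̇-ι*-⊗₁-ρ (∁ (∁ A)) eⁿ J _) ⟩
    tensorOn μ (∁ A) (χ̇ μ K) (χ̇ μ L) g
      ≡⟨ χ̇-tensorOn (∁ A) K L g ⟩
    χ̇ μ (merge (∁ A) K L) g
      ≡⟨ cong (λ M → χ̇ μ M g) (merge-pick (∁ A) K L) ⟩
    χ̇ μ (pick μ (∁ A) (toList K) ∪ pick μ (∁ (∁ A)) (toList L)) g
      ≡⟨ cong (λ M → χ̇ μ M g) (cong₂ _∪_ (pick-cast-∷ʳ-false (∁ A) eᵐ I)
                                          (pick-cast-∷ʳ-false (∁ (∁ A)) eⁿ J)) ⟩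
    χ̇ μ (pick μ (∁ A) (toList I) ∪ pick μ (∁ (∁ A)) (toList J)) g
      ≡⟨ cong (λ S → χ̇ μ (pick μ (∁ A) (toList I) ∪ pick μ S (toList J)) g) (∁-involutive A) ⟩
    χ̇ μ (pick μ (∁ A) (toList I) ∪ pick μ A (toList J)) g ∎
    where
    eᵐ = card∁ μ (suc m) (suc n) A hA
    eⁿ = card∁∁ μ (suc n) A hA
    K = cast (sym eᵐ) (I ∷ʳ false)
    L = cast (sym eⁿ) (J ∷ʳ false)

  mA-χ̇-suc : ∀ m n (A : Subset (suc m + suc n)) (hA : ∣ A ∣ ≡ suc n) (I : Subset m) (J : Subset n) g →
             mA μ (suc m) (suc n) A hA (χ̇ μ I) (χ̇ μ J) g ≡ χ̇ μ (shuffle μ (suc m) (suc n) A I J) g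
  mA-χ̇-suc m n A hA I J g = begin
    χ̇ μ C₁ (proj μ C g) * sA μ m n A hA (χ̇ μ I) (χ̇ μ J) (embed μ (∁ C) h ∷ʳ zero)
      ≡⟨ cong (χ̇ μ C₁ (proj μ C g) *_) (begin
           sA μ m n A hA (χ̇ μ I) (χ̇ μ J) (embed μ (∁ C) h ∷ʳ zero)
             ≡⟨ sA-χ̇ m n A hA I J _ ⟩
           χ̇ μ P (embed μ (∁ C) h ∷ʳ zero)
             ≡⟨ χ̇-∷ʳ-zero P (embed μ (∁ C) h) ⟩
           χ̇ μ (dropLast μ P) (embed μ (∁ C) h)
             ≡⟨ χ̇-embed (∁ C) (dropLast μ P) h ⟩
           χ̇ μ (proj μ (∁ C) (dropLast μ P)) h ∎) ⟩
    tensorOn μ C (χ̇ μ C₁) (χ̇ μ (proj μ (∁ C) (dropLast μ P))) g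
      ≡⟨ χ̇-tensorOn C C₁ (proj μ (∁ C) (dropLast μ P)) g ⟩
    χ̇ μ (merge C C₁ (proj μ (∁ C) (dropLast μ P))) g
      ≡⟨ cong (λ M → χ̇ μ M g) (merge-proj (c₁ μ A) (c₂ μ A) (dropLast μ P)) ⟩
    χ̇ μ (shuffle μ (suc m) (suc n) A I J) g ∎
    where
    C = c μ A
    C₁ = proj μ C (c₁ μ A)
    P = pick μ (∁ A) (toList I) ∪ pick μ A (toList J)
    h = proj μ (∁ C) g

  shuffle≡preshuffle : ∀ m n (A : Subset (m + n)) I J → c₁ μ A ≡ ⊥ → c₂ μ A ≡ ⊥ →
                       shuffle μ m n A I J ≡ preshuffle μ m n A I J
  shuffle≡preshuffle m n A I J c₁≡⊥ c₂≡⊥ = begin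
    c₁ μ A ∪ (P ─ (c₁ μ A ∪ c₂ μ A))   ≡⟨ cong₂ (λ X Z → X ∪ (P ─ (X ∪ Z))) c₁≡⊥ c₂≡⊥ ⟩
    ⊥ ∪ (P ─ (⊥ ∪ ⊥))                  ≡⟨ ∪-identityˡ _ ⟩
    P ─ (⊥ ∪ ⊥)                        ≡⟨ cong (P ─_) (∪-identityˡ ⊥) ⟩
    P ─ ⊥                              ≡⟨ p─⊥≡p P ⟩
    P                                  ∎
    where P = preshuffle μ m n A I J

  shuffle-⊤ : ∀ k (J : Subset k) → shuffle μ 0 (suc k) ⊤ [] J ≡ J
  shuffle-⊤ k J = begin
    shuffle μ 0 (suc k) ⊤ [] J
      ≡⟨ shuffle≡preshuffle 0 (suc k) ⊤ [] J (ends-replicate (suc k) true)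
           (trans (cong (ends μ) ∁⊤≡⊥) (ends-replicate (suc k) false)) ⟩
    dropLast μ (pick μ (∁ ⊤) List.[] ∪ pick μ ⊤ (toList J))
      ≡⟨ cong (λ X → dropLast μ (X ∪ pick μ ⊤ (toList J))) (pick-[] (∁ ⊤)) ⟩
    dropLast μ (⊥ ∪ pick μ ⊤ (toList J))
      ≡⟨ cong (dropLast μ) (trans (∪-identityˡ _) (pick-⊤ J)) ⟩
    dropLast μ (J ∷ʳ false)
      ≡⟨ dropLast-∷ʳ J false ⟩
    J ∎

  shuffle-⊥ : ∀ k (I : Subset k) → shuffle μ (suc k) 0 ⊥ I [] ≡ cast (sym (+-identityʳ k)) I
  shuffle-⊥ k I = begin
    shuffle μ (suc k) 0 ⊥ I []
      ≡⟨ shuffle≡preshuffle (suc k) 0 ⊥ I [] (ends-replicate (suc k + 0) false)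
           (trans (cong (ends μ) ∁⊥≡⊤) (ends-replicate (suc k + 0) true)) ⟩
    dropLast μ (pick μ (∁ ⊥) (toList I) ∪ pick μ ⊥ List.[])
      ≡⟨ cong₂ (λ S X → dropLast μ (pick μ S (toList I) ∪ X)) ∁⊥≡⊤ (pick-[] ⊥) ⟩
    dropLast μ (pick μ ⊤ (toList I) ∪ ⊥)
      ≡⟨ cong (dropLast μ) (trans (∪-identityʳ _) (cong (pick μ ⊤) (sym (toList-cast e I)))) ⟩
    dropLast μ (pick μ ⊤ (toList (cast e I)))
      ≡⟨ cong (dropLast μ) (pick-⊤ (cast e I)) ⟩
    dropLast μ (cast e I ∷ʳ false)
      ≡⟨ dropLast-∷ʳ (cast e I) false ⟩
    cast e I ∎
    where e = sym (+-identityʳ k)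

  mA-χ̇ : ∀ m n (A : Subset (m + n)) (hA : ∣ A ∣ ≡ n) (I : Subset (pred m)) (J : Subset (pred n)) g →
         mA μ m n A hA (χ̇ μ I) (χ̇ μ J) g ≡ χ̇ μ (shuffle μ m n A I J) g
  mA-χ̇ zero    zero    [] hA [] [] [] = *-identityˡ 1ℚ
  mA-χ̇ zero    (suc n) A  hA [] J  g  with ∣p∣≡n⇒p≡⊤ {p = A} hA
  ... | refl = trans (*-identityˡ _) (cong (λ K → χ̇ μ K g) (sym (shuffle-⊤ n J)))
  mA-χ̇ (suc m) zero    A  hA I  [] g  with ∣p∣≡0⇒p≡⊥ A hA
  ... | refl = begin
    χ̇ μ I (cast (+-identityʳ m) g) * 1ℚ   ≡⟨ *-identityʳ _ ⟩
    χ̇ μ I (cast (+-identityʳ m) g)        ≡⟨ χ̇-cast (+-identityʳ m) I g ⟩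
    χ̇ μ (cast (sym (+-identityʳ m)) I) g  ≡⟨ cong (λ K → χ̇ μ K g) (shuffle-⊥ m I) ⟨
    χ̇ μ (shuffle μ (suc m) 0 ⊥ I []) g    ∎
  mA-χ̇ (suc m) (suc n) A  hA I  J  g  = mA-χ̇-suc m n A hA I J g

  χ̇-glue : ∀ n k eq (I : Subset (pred n)) a b →
           χ̇ μ I (glue μ n k eq a b) ≡ χ̇ μ (lowPart n k eq I) a * χ̇ μ (highPart n k eq I) b
  χ̇-glue n k eq I a b with splitAt (pred k) (cast (sym eq) I)
  ... | L , x ∷ H , split = begin
    χ̇ μ I (cast eq (a ++ zero ∷ b))       ≡⟨ χ̇-cast eq I (a ++ zero ∷ b) ⟩
    χ̇ μ (cast (sym eq) I) (a ++ zero ∷ b) ≡⟨ cong (λ K → χ̇ μ K (a ++ zero ∷ b)) split ⟩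
    χ̇ μ (L ++ x ∷ H) (a ++ zero ∷ b)      ≡⟨ χ̇-++ L (x ∷ H) a (zero ∷ b) ⟩
    χ̇ μ L a * χ̇ μ (x ∷ H) (zero ∷ b)      ≡⟨ cong (χ̇ μ L a *_) (χ̇-∷-zero x H b) ⟩
    χ̇ μ L a * χ̇ μ H b                     ∎

  triangle-χ̇ : ∀ n k eq (I : Subset (pred n)) →
               TriangleIs μ n k eq (χ̇ μ I) (λ a b → χ̇ μ (lowPart n k eq I) a * χ̇ μ (highPart n k eq I) b)
  triangle-χ̇ n k eq I =
    (χ̇ μ (lowPart n k eq I) , χ̇ μ (highPart n k eq I) , χ̇-glue n k eq I) ,
    λ φ₁ φ₂ decomposes a b → trans (sym (decomposes a b)) (χ̇-glue n k eq I a b)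

lemma3p7 : (μ : ℕ) →
    -- (a)
    (∀ (m n : ℕ) (A : Subset (m + n)) (hA : ∣ A ∣ ≡ n)
       (I : Subset (pred m)) (J : Subset (pred n)) (g : G μ (pred (m + n))) →
       mA μ m n A hA (χ̇ μ I) (χ̇ μ J) g ≡ χ̇ μ (shuffle μ m n A I J) g)
    ×
    -- (b)
    (∀ (n k : ℕ) (hn : 2 ≤ n) (hk₁ : 1 ≤ k) (hk₂ : k < n) (I : Subset (pred n)) →
       TriangleIs μ n k (splitEq μ n k hk₁ hk₂) (χ̇ μ I)
         (λ a b → χ̇ μ (lowPart n k (splitEq μ n k hk₁ hk₂) I) a
                  * χ̇ μ (highPart n k (splitEq μ n k hk₁ hk₂) I) b))
lemma3p7 μ = mA-χ̇ μ , λ n k _ hk₁ hk₂ → triangle-χ̇ μ n k (splitEq μ n k hk₁ hk₂)
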